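{- Let $k$ be an even positive integer. Then $S_3(k;2)=S_{3,2}(k;2)=2k-3$.
   Context: For positive integers $k,r$ with $r\mid k$: a solution to $\mathcal{E}$ is a $k$-tuple $(x_1,\dots,x_k)$ of positive integers (not necessarily distinct) with $\sum_{i=1}^{k-1}x_i=x_k$. Given a coloring $\chi$ of a set of positive integers by non-negative integers, a solution is called $r$-zero-sum if $\sum_{i=1}^k\chi(x_i)\equiv 0\pmod r$. $S_3(k;r)$ denotes the minimum positive integer $n$ such that every coloring $\chi:\{1,\dots,n\}\to\{0,1,\dots,r-1\}$ admits an $r$-zero-sum solution to $\mathcal{E}$ with all $x_i\in\{1,\dots,n\}$. $S_{3,2}(k;r)$ denotes the minimum positive integer $n$ such that every coloring $\chi:\{1,\dots,n\}\to\{0,1\}$ admits an $r$-zero-sum solution to $\mathcal{E}$ with all $x_i\in\{1,\dots,n\}$. (If no such $n$ exists the value is $\infty$.) -}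

module Defs where

open import Data.Nat using (ℕ; zero; suc; _+_; _≤_; _<_)
open import Data.Nat.Divisibility using (_∣_)
open import Data.Fin using (Fin; toℕ)
import Data.Fin as F
open import Data.Product using (Σ; _×_)
open import Data.Empty using (⊥)
open import Relation.Nullary using (¬_)
open import Relation.Binary.PropositionalEquality using (_≡_)

sumFin : (m : ℕ) → (Fin m → ℕ) → ℕ
sumFin zero    f = 0
sumFin (suc m) f = f F.zero + sumFin m (λ i → f (F.suc i))

-- A k-tuple (x_1,...,x_k) with k = suc m is represented by
-- y : Fin m → ℕ  (x_1..x_{k-1}) and z : ℕ (x_k).
ZeroSumSol : (c r n k : ℕ) → (ℕ → Fin c) → Set
ZeroSumSol c r n zero    χ = ⊥
ZeroSumSol c r n (suc m) χ =
  Σ (Fin m → ℕ) λ y → Σ ℕ λ z →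
    (∀ i → 1 ≤ y i × y i ≤ n) × (1 ≤ z × z ≤ n) ×
    (sumFin m y ≡ z) ×
    (r ∣ (sumFin m (λ i → toℕ (χ (y i))) + toℕ (χ z)))

-- Colorings are given as functions on ℕ; only
-- their values on {1,...,n} matter, and every coloring of {1,...,n} extends.
Forces : (c r k n : ℕ) → Set
Forces c r k n = (χ : ℕ → Fin c) → ZeroSumSol c r n k χ

IsMinPos : (ℕ → Set) → ℕ → Set
IsMinPos P n = 1 ≤ n × P n × (∀ m → 1 ≤ m → m < n → ¬ P m)

S3Is : (k r n : ℕ) → Set
S3Is k r n = IsMinPos (Forces r r k) n

S32Is : (k r n : ℕ) → Set
S32Is k r n = IsMinPos (Forces 2 r k) n

module Submission where

-- Proof idea.  Write k = 2t + 2, so a solution of E consists of m = 2t + 1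
-- summands y₁,…,y_m and their sum z, and 2k - 3 = 4t + 1 = m + 2t.
--
-- Two of the three numbers 1, 2t+1, 4t+1 receive the same colour.  Each of
-- the three possible pairs (a, z) is the first summand and the sum of a
-- solution (a, b, …, b ; z) with 2t copies of b, whose colour sum
-- χ(a) + 2t·χ(b) + χ(z) = 2χ(a) + 2t·χ(b) is even:
--   (1, 1,…,1 ; 2t+1),   (2t+1, 1,…,1 ; 4t+1),   (1, 2,…,2 ; 4t+1).
--
-- For n ≤ 4t colour x by 0 if x ≤ 2t and by 1 otherwise.  In
-- any solution inside {1,…,n} the sum exceeds 2t, while each summand plus the
-- 2t other summands is at most n ≤ 4t, so every summand is at most 2t: the
-- colour sum is exactly 1, which no r > 1 divides.
--
-- Since r = 2, the colour sets {0,…,r-1} and {0,1} coincide and both claimed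
-- values are the same minimum.

open import Defs
open import Data.Nat using (ℕ; _+_; _∸_; _*_; _<_)
open import Data.Nat.Divisibility using (_∣_)
open import Data.Product using (_×_)

open import Data.Nat using (zero; suc; _≤_; _≤?_; z≤n; s≤s)
open import Data.Nat.Properties
open import Data.Nat.Divisibility using (divides; ∣1⇒≡1)
open import Data.Nat.Tactic.RingSolver using (solve-∀)
open import Data.Fin using (Fin; toℕ)
import Data.Fin as F
open import Data.Vec.Functional using (_∷_; replicate)
open import Data.Product using (_,_; proj₁)
open import Data.Sum using (_⊎_; inj₁; inj₂)
open import Relation.Nullary using (¬_; yes; no; contradiction)
open import Relation.Binary.PropositionalEquality

sumFin-const : ∀ m c → sumFin m (λ _ → c) ≡ m * c
sumFin-const zero    c = refl
sumFin-const (suc m) c = cong (c +_) (sumFin-const m c)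

sumFin-zero : ∀ m (f : Fin m → ℕ) → (∀ i → f i ≡ 0) → sumFin m f ≡ 0
sumFin-zero zero    f f≡0 = refl
sumFin-zero (suc m) f f≡0 rewrite f≡0 F.zero =
  sumFin-zero m (λ i → f (F.suc i)) (λ i → f≡0 (F.suc i))

length≤sumFin : ∀ m (y : Fin m → ℕ) → (∀ i → 1 ≤ y i) → m ≤ sumFin m y
length≤sumFin zero    y pos = z≤n
length≤sumFin (suc m) y pos =
  +-mono-≤ (pos F.zero) (length≤sumFin m (λ i → y (F.suc i)) (λ i → pos (F.suc i)))

term+rest≤sumFin : ∀ m (y : Fin (suc m) → ℕ) → (∀ i → 1 ≤ y i) →
                   ∀ i → y i + m ≤ sumFin (suc m) y
term+rest≤sumFin m y pos F.zero =
  +-monoʳ-≤ (y F.zero) (length≤sumFin m (λ i → y (F.suc i)) (λ i → pos (F.suc i)))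
term+rest≤sumFin (suc m) y pos (F.suc i) = begin
  y (F.suc i) + suc m   ≡⟨ +-suc (y (F.suc i)) m ⟩
  suc (y (F.suc i) + m) ≤⟨ +-mono-≤ (pos F.zero) rest ⟩
  sumFin (suc (suc m)) y ∎
  where
  open ≤-Reasoning
  rest = term+rest≤sumFin m (λ j → y (F.suc j)) (λ j → pos (F.suc j)) i

-- The colour sum of (a, b, …, b ; a) with 2t copies of b is twice an integer.
evenTailIdentity : ∀ u t v → u + t * 2 * v + u ≡ (u + t * v) * 2
evenTailIdentity = solve-∀

-- 1 + 2t·2 = 4t + 1, used for the tuple (1, 2, …, 2 ; 4t+1).
oneTwosIdentity : ∀ s → suc s * 2 * 2 ≡ suc s * 2 + suc s * 2
oneTwosIdentity = solve-∀

InRange : ℕ → ℕ → Set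
InRange n x = 1 ≤ x × x ≤ n

headTailSolution : ∀ {c n} (χ : ℕ → Fin c) t a b z →
  InRange n a → InRange n b → InRange n z →
  a + t * 2 * b ≡ z → χ a ≡ χ z →
  ZeroSumSol c 2 n (suc (suc (t * 2))) χ
headTailSolution χ t a b z a∈ b∈ z∈ sum≡z χa≡χz =
  a ∷ replicate (t * 2) b , z ,
  (λ { F.zero → a∈ ; (F.suc _) → b∈ }) , z∈ ,
  trans (cong (a +_) (sumFin-const (t * 2) b)) sum≡z ,
  subst (λ w → 2 ∣ toℕ (χ a) + sumFin (t * 2) (λ _ → toℕ (χ b)) + toℕ w)
        χa≡χz (colourSumEven (toℕ (χ a)) (toℕ (χ b)))
  where
  colourSumEven : ∀ u v → 2 ∣ u + sumFin (t * 2) (λ _ → v) + u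
  colourSumEven u v = divides (u + t * v) (begin
    u + sumFin (t * 2) (λ _ → v) + u ≡⟨ cong (λ s → u + s + u) (sumFin-const (t * 2) v) ⟩
    u + t * 2 * v + u               ≡⟨ evenTailIdentity u t v ⟩
    (u + t * v) * 2                 ∎)
    where open ≡-Reasoning

twoOfThreeEqual : (a b c : Fin 2) → a ≡ b ⊎ b ≡ c ⊎ a ≡ c
twoOfThreeEqual F.zero         F.zero         _              = inj₁ refl
twoOfThreeEqual F.zero         (F.suc F.zero) F.zero         = inj₂ (inj₂ refl)
twoOfThreeEqual F.zero         (F.suc F.zero) (F.suc F.zero) = inj₂ (inj₁ refl)
twoOfThreeEqual (F.suc F.zero) F.zero         F.zero         = inj₂ (inj₁ refl)
twoOfThreeEqual (F.suc F.zero) F.zero         (F.suc F.zero) = inj₂ (inj₂ refl)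
twoOfThreeEqual (F.suc F.zero) (F.suc F.zero) _              = inj₁ refl

forcesAtTop : ∀ t → Forces 2 2 (suc (suc (t * 2))) (suc (t * 2 + t * 2))
forcesAtTop t χ = fromEqualPair (twoOfThreeEqual (χ 1) (χ m) (χ n))
  where
  m n : ℕ
  m = suc (t * 2)
  n = suc (t * 2 + t * 2)
  one∈ : InRange n 1
  one∈ = ≤-refl , s≤s z≤n
  m∈ : InRange n m
  m∈ = s≤s z≤n , s≤s (m≤m+n (t * 2) (t * 2))
  n∈ : InRange n n
  n∈ = s≤s z≤n , ≤-refl

  -- (1, 2, …, 2 ; 4t+1); for t = 0 there are no 2s and it is the tuple (1 ; 1).
  oneTwos : ∀ s → χ 1 ≡ χ (suc (s * 2 + s * 2)) →
            ZeroSumSol 2 2 (suc (s * 2 + s * 2)) (suc (suc (s * 2))) χ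
  oneTwos zero    eq = headTailSolution χ 0 1 1 1 (≤-refl , ≤-refl) (≤-refl , ≤-refl)
                         (≤-refl , ≤-refl) refl eq
  oneTwos (suc s) eq = headTailSolution χ (suc s) 1 2 _ (≤-refl , s≤s z≤n)
                         (s≤s z≤n , s≤s (s≤s z≤n)) (s≤s z≤n , ≤-refl) (cong suc (oneTwosIdentity s)) eq

  fromEqualPair : χ 1 ≡ χ m ⊎ χ m ≡ χ n ⊎ χ 1 ≡ χ n → ZeroSumSol 2 2 n (suc (suc (t * 2))) χ
  fromEqualPair (inj₁ χ1≡χm) =
    headTailSolution χ t 1 1 m one∈ one∈ m∈ (cong suc (*-identityʳ (t * 2))) χ1≡χm
  fromEqualPair (inj₂ (inj₁ χm≡χn)) =
    headTailSolution χ t m 1 n m∈ one∈ n∈ (cong (m +_) (*-identityʳ (t * 2))) χm≡χn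
  fromEqualPair (inj₂ (inj₂ χ1≡χn)) = oneTwos t χ1≡χn

threshold : ℕ → ℕ → Fin 2
threshold B x with x ≤? B
... | yes _ = F.zero
... | no  _ = F.suc F.zero

threshold-≤ : ∀ B x → x ≤ B → toℕ (threshold B x) ≡ 0
threshold-≤ B x x≤B with x ≤? B
... | yes _   = refl
... | no  x≰B = contradiction x≤B x≰B

threshold-> : ∀ B x → B < x → toℕ (threshold B x) ≡ 1
threshold-> B x B<x with x ≤? B
... | yes x≤B = contradiction x≤B (<⇒≱ B<x)
... | no  _   = refl

-- With B + 1 summands and all values at most 2B, the threshold colouring at B
-- gives every solution the colour sum 1, so no solution is r-zero-sum for r > 1.
thresholdAvoids : ∀ B n r → 1 < r → n ≤ B + B →
                  ¬ ZeroSumSol 2 r n (suc (suc B)) (threshold B)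
thresholdAvoids B n r 1<r n≤2B (y , z , y∈ , (_ , z≤bound) , sum≡z , r∣colours) =
  <⇒≢ 1<r (sym (∣1⇒≡1 (subst (r ∣_) colourSum≡1 r∣colours)))
  where
  pos : ∀ i → 1 ≤ y i
  pos i = proj₁ (y∈ i)
  B<z : B < z
  B<z = subst (suc B ≤_) sum≡z (length≤sumFin (suc B) y pos)
  y≤B : ∀ i → y i ≤ B
  y≤B i = +-cancelʳ-≤ B (y i) B (begin
    y i + B              ≤⟨ term+rest≤sumFin B y pos i ⟩
    sumFin (suc B) y     ≡⟨ sum≡z ⟩
    z                    ≤⟨ z≤bound ⟩
    n                    ≤⟨ n≤2B ⟩
    B + B                ∎)
    where open ≤-Reasoning
  colourSum≡1 : sumFin (suc B) (λ i → toℕ (threshold B (y i))) + toℕ (threshold B z) ≡ 1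
  colourSum≡1 = cong₂ _+_
    (sumFin-zero (suc B) _ (λ i → threshold-≤ B (y i) (y≤B i)))
    (threshold-> B z B<z)

doubleIdentity : ∀ t → 2 * (suc t * 2) ≡ 3 + suc (t * 2 + t * 2)
doubleIdentity = solve-∀

twiceMinusThree : ∀ t → 2 * (suc t * 2) ∸ 3 ≡ suc (t * 2 + t * 2)
twiceMinusThree t = cong (_∸ 3) (doubleIdentity t)

minimumForEvenK : ∀ t → IsMinPos (Forces 2 2 (suc (suc (t * 2)))) (suc (t * 2 + t * 2))
minimumForEvenK t =
  s≤s z≤n , forcesAtTop t ,
  λ n _ n<top forces → thresholdAvoids (t * 2) n 2 ≤-refl (≤-pred n<top) (forces (threshold (t * 2)))

proposition3 : (k : ℕ) → 0 < k → 2 ∣ k →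
    S3Is k 2 (2 * k ∸ 3) × S32Is k 2 (2 * k ∸ 3)
proposition3 k () (divides zero refl)
proposition3 k _  (divides (suc t) refl) rewrite twiceMinusThree t =
  minimumForEvenK t , minimumForEvenK t
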